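{- Let $H$ be a connected bipartite graph with more than one edge such that, for some edge $(a,b)$ of $H$, $(H,a,b)$ is involution-free. Then $H$ has an even gadget.
   Context: Graphs are finite, simple, undirected, loopless. $(H,a,b)$ is involution-free if $H$ has no automorphism of order $2$ that fixes both $a$ and $b$. For graphs with distinguished vertices, $\mathrm{Hom}((G,w,x),(H,a,b))$ is the set of graph homomorphisms $\sigma:G\to H$ (edges to edges) with $\sigma(w)=a$, $\sigma(x)=b$. An even gadget for a bipartite graph $H$ with at least one edge is an edge $(a,b)$ of $H$ together with a connected bipartite graph $G$ with a distinguished edge $(w,x)$ such that $|\mathrm{Hom}((G,w,x),(H,a,b))|$ is even. -}

module Defs where

open import Data.Nat using (ℕ; zero; suc; _*_)
open import Data.Bool using (Bool; true; false; _∧_)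
open import Data.Fin using (Fin)
open import Data.Fin.Properties using () renaming (_≟_ to _≟ᶠ_)
open import Data.Vec using (Vec; []; _∷_; lookup)
open import Data.List using (List; []; _∷_; map; concatMap; length; filterᵇ; allFin)
open import Data.Bool.ListAction using (and)
open import Data.Product using (Σ; ∃; _×_; _,_)
open import Data.Sum using (_⊎_)
open import Relation.Nullary using (¬_)
open import Relation.Binary.PropositionalEquality using (_≡_; _≢_)
open import Relation.Nullary.Decidable using (⌊_⌋)

record Graph : Set where
  field
    n      : ℕ
    adj    : Fin n → Fin n → Bool
    sym    : ∀ u v → adj u v ≡ adj v u
    irrefl : ∀ u → adj u u ≡ false
open Graph public

Vertex : Graph → Set
Vertex G = Fin (n G)

Edge : (G : Graph) → Vertex G → Vertex G → Set
Edge G u v = adj G u v ≡ true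

data Walk (G : Graph) : Vertex G → Vertex G → Set where
  []  : ∀ {u} → Walk G u u
  _∷_ : ∀ {u v w} → Edge G u v → Walk G v w → Walk G u w

Connected : Graph → Set
Connected G = ∀ (u v : Vertex G) → Walk G u v

Bipartite : Graph → Set
Bipartite G = Σ (Vertex G → Bool) λ c → ∀ u v → Edge G u v → c u ≢ c v

MoreThanOneEdge : Graph → Set
MoreThanOneEdge G =
  Σ (Vertex G) λ u → Σ (Vertex G) λ v → Σ (Vertex G) λ u' → Σ (Vertex G) λ v' →
    Edge G u v × Edge G u' v' ×
    ¬ ((u ≡ u' × v ≡ v') ⊎ (u ≡ v' × v ≡ u'))

record Automorphism (H : Graph) : Set where
  field
    fun     : Vertex H → Vertex H
    inv     : Vertex H → Vertex H
    inv-l   : ∀ u → inv (fun u) ≡ u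
    inv-r   : ∀ u → fun (inv u) ≡ u
    preserv : ∀ u v → adj H (fun u) (fun v) ≡ adj H u v
open Automorphism public

HasOrder2 : {H : Graph} → Automorphism H → Set
HasOrder2 φ = (∀ u → fun φ (fun φ u) ≡ u) × Σ _ λ u → fun φ u ≢ u

InvolutionFree : (H : Graph) → Vertex H → Vertex H → Set
InvolutionFree H a b =
  ¬ (Σ (Automorphism H) λ φ → HasOrder2 φ × fun φ a ≡ a × fun φ b ≡ b)

-- all maps Fin m → Fin k, represented as vectors
allVecs : (m k : ℕ) → List (Vec (Fin k) m)
allVecs zero    k = [] ∷ []
allVecs (suc m) k = concatMap (λ i → map (i ∷_) (allVecs m k)) (allFin k)

isHomᵇ : (G H : Graph) → Vertex G → Vertex G → Vertex H → Vertex H →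
         Vec (Vertex H) (n G) → Bool
isHomᵇ G H w x a b σ =
  ⌊ lookup σ w ≟ᶠ a ⌋ ∧ ⌊ lookup σ x ≟ᶠ b ⌋ ∧
  and (concatMap (λ u → map (λ v → impl (adj G u v) (adj H (lookup σ u) (lookup σ v)))
                            (allFin (n G)))
                 (allFin (n G)))
  where
  impl : Bool → Bool → Bool
  impl true  q = q
  impl false _ = true

homCount : (G H : Graph) → Vertex G → Vertex G → Vertex H → Vertex H → ℕ
homCount G H w x a b = length (filterᵇ (isHomᵇ G H w x a b) (allVecs (n G) (n H)))

Even : ℕ → Set
Even k = Σ ℕ λ j → k ≡ 2 * j

HasEvenGadget : Graph → Set
HasEvenGadget H =
  Σ (Vertex H) λ a → Σ (Vertex H) λ b → Edge H a b ×
  Σ Graph λ G → Connected G × Bipartite G ×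
  Σ (Vertex G) λ w → Σ (Vertex G) λ x → Edge G w x ×
  Even (homCount G H w x a b)

-- Let inj_j(G, T) count the homomorphisms (G,w,x) → (T,a,b) that are injective on
-- the first j vertices of G. Such a homomorphism either stays injective on vertex j,
-- or maps j to the image of exactly one earlier vertex u, and then it factors through
-- the gadget G/(u = j) obtained by identifying u with j:
--   inj_j(G, T) = inj_{j+1}(G, T) + Σ_{u<j} inj_j(G/(u = j), T).
-- Into a bipartite target, vertices on different sides are never identified, and
-- identifying two vertices on the same side yields again a connected bipartite gadget.
-- Every gadget has exactly one homomorphism to (K₂,0,1); so unless some gadget has an
-- even number of homomorphisms to (H,a,b), induction on j gives
-- inj_j(G, H) ≡ inj_j(G, K₂) (mod 2) for all gadgets G. Take G = H and j = |V(H)|: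
-- the left side counts the automorphisms of H fixing a and b, an odd number since
-- inversion pairs them up and, H being involution-free, only the identity is its own
-- inverse; the right side is 0, as H has at least three vertices.

module Submission where

open import Data.Bool using (Bool; true; false; _∧_; _∨_; not; _xor_) renaming (_≟_ to _≟ᵇ_)
open import Data.Bool.ListAction using (and)
open import Data.Bool.Properties
  using (¬-not; ∧-identityʳ; ∨-comm; ∨-zeroʳ; ⇔→≡; not-injective; xor-same; xor-inverseʳ; xor-annihilates-not)
open import Data.Empty using (⊥)
open import Data.Fin using (Fin; zero; suc; toℕ; punchIn; punchOut; fromℕ<) renaming (_<_ to _<ᶠ_)
open import Data.Fin.Properties
  using (_≟_; all?; any?; ¬∀⟶∃¬; injective⇒≤; toℕ<n; toℕ-injective; toℕ-fromℕ<;
         punchInᵢ≢i; punchIn-injective; punchIn-punchOut; punchOut-punchIn; punchOut-cong; punchOut-injective)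
  renaming (_<?_ to _<ᶠ?_; <-cmp to <ᶠ-cmp)
open import Data.List using (List; []; _∷_; _++_; map; concatMap; length; filterᵇ; allFin; tabulate)
open import Data.List.Properties using (map-tabulate)
open import Data.List.Relation.Unary.All using (All; []; _∷_)
open import Data.List.Relation.Unary.Any using (Any; here; there)
import Data.List.Relation.Unary.All.Properties as All
import Data.List.Relation.Unary.Any.Properties as Any
open import Data.Nat using (ℕ; zero; suc; _+_; _*_; _<_; _≤_; z≤n; s≤s; parity)
open import Data.Nat.Properties
  using (_<?_; ≤-refl; ≤-reflexive; ≤-trans; ≤-pred; <⇒≤; <-irrefl; n≤1+n; 1+n≰n; m<1+n⇒m<n∨m≡n;
         +-mono-≤; +-assoc; +-comm; +-identityʳ; +-cancelˡ-≡; *-comm; *-assoc; *-zeroʳ; *-identityʳ; *-suc; *-distribˡ-+)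
open import Data.Parity.Base using (0ℙ; 1ℙ) renaming (_+_ to _+ℙ_)
import Data.Parity.Properties as ℙ
open import Data.Product using (Σ; ∃; ∃₂; _×_; _,_; proj₁; proj₂)
open import Data.Sum using (_⊎_; inj₁; inj₂)
open import Data.Vec using (Vec; []; _∷_; lookup; insertAt) renaming (tabulate to tabulateᵛ)
open import Data.Vec.Properties
  using (≡-dec; insertAt-lookup; insertAt-punchIn; lookup∘tabulate; tabulate∘lookup; tabulate-cong)
import Data.Vec.Relation.Binary.Lex.Strict as Lex
open import Data.Vec.Relation.Binary.Pointwise.Inductive using (Pointwise-≡⇒≡; ≡⇒Pointwise-≡)
open import Function using (_∘_; id; mk⇔; case_of_)
open import Function.Definitions using (Injective)
open import Relation.Binary.Definitions using (Tri; tri<; tri≈; tri>)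
open import Relation.Binary.PropositionalEquality
open import Relation.Nullary using (¬_; Dec; yes; no; does; contradiction)
open import Relation.Nullary.Decidable using (⌊_⌋; isYes≗does; dec-true; dec-false; does-⇔; _×-dec_; _→-dec_)
open ≡-Reasoning

open import Defs hiding (sym)

private
  variable
    A B : Set
    k m N : ℕ

does⇒ : {P : Set} (P? : Dec P) → does P? ≡ true → P
does⇒ (yes p) _ = p

⌊⌋⇒ : {P : Set} (P? : Dec P) → ⌊ P? ⌋ ≡ true → P
⌊⌋⇒ (yes p) _ = p

⌊⌋-yes : {P : Set} (P? : Dec P) → P → ⌊ P? ⌋ ≡ true
⌊⌋-yes P? p = trans (isYes≗does P?) (dec-true P? p)

∧-false : ∀ {b c} → b ∧ c ≡ false → b ≡ false ⊎ c ≡ false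
∧-false {false} _ = inj₁ refl
∧-false {true}  e = inj₂ e

∧-true : ∀ {b c} → b ∧ c ≡ true → b ≡ true × c ≡ true
∧-true {true} {true} _ = refl , refl

∨-true : ∀ {b c} → b ∨ c ≡ true → b ≡ true ⊎ c ≡ true
∨-true {true}  _ = inj₁ refl
∨-true {false} e = inj₂ e

xor-cancelˡ : ∀ a {b c} → a xor b ≡ a xor c → b ≡ c
xor-cancelˡ false e = e
xor-cancelˡ true  e = not-injective e

xor-solve : ∀ a b {c} → a xor b ≡ c → a ≡ c xor b
xor-solve true  true  refl = refl
xor-solve true  false refl = refl
xor-solve false true  refl = refl
xor-solve false false refl = refl

_=ᶠ_ : Fin k → Fin k → Bool
i =ᶠ j = does (i ≟ j)

=ᶠ-sym : (x y : Fin k) → (x =ᶠ y) ≡ (y =ᶠ x)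
=ᶠ-sym x y = does-⇔ (mk⇔ sym sym) (x ≟ y) (y ≟ x)

_=ᵛ_ : Vec (Fin k) N → Vec (Fin k) N → Bool
σ =ᵛ τ = does (≡-dec _≟_ σ τ)

=ᵛ-refl : (σ : Vec (Fin k) N) → σ =ᵛ σ ≡ true
=ᵛ-refl σ = dec-true (≡-dec _≟_ σ σ) refl

lookup-ext : {σ τ : Vec A N} → (∀ i → lookup σ i ≡ lookup τ i) → σ ≡ τ
lookup-ext {σ = σ} {τ} σ≗τ = trans (sym (tabulate∘lookup σ)) (trans (tabulate-cong σ≗τ) (tabulate∘lookup τ))

and-true⇒All : ∀ {bs} → and bs ≡ true → All (_≡ true) bs
and-true⇒All {[]}     _ = []
and-true⇒All {b ∷ bs} e = proj₁ (∧-true e) ∷ and-true⇒All (proj₂ (∧-true e))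

and-false⇒Any : ∀ {bs} → and bs ≡ false → Any (_≡ false) bs
and-false⇒Any {true ∷ bs}  e = there (and-false⇒Any e)
and-false⇒Any {false ∷ bs} _ = here refl

and-allPairs-true : {g : Fin N → Fin N → Bool} →
  and (concatMap (λ u → map (g u) (allFin N)) (allFin N)) ≡ true → ∀ u v → g u v ≡ true
and-allPairs-true e u v =
  All.tabulate⁻ (All.map⁻ (All.tabulate⁻ (All.map⁻ (All.concat⁻ (and-true⇒All e))) u)) v

and-allPairs-false : {g : Fin N → Fin N → Bool} →
  and (concatMap (λ u → map (g u) (allFin N)) (allFin N)) ≡ false → ∃₂ λ u v → g u v ≡ false
and-allPairs-false e with Any.tabulate⁻ (Any.map⁻ (Any.concat⁻ _ (and-false⇒Any e)))
... | u , fails = u , Any.tabulate⁻ (Any.map⁻ fails)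

-- Finite sums and counting

∑ : (A → ℕ) → List A → ℕ
∑ f []       = 0
∑ f (x ∷ xs) = f x + ∑ f xs

syntax ∑ (λ x → t) xs = ∑[ x ∈ xs ] t

𝟙 : Bool → ℕ
𝟙 true  = 1
𝟙 false = 0

count : (A → Bool) → List A → ℕ
count P xs = ∑[ x ∈ xs ] 𝟙 (P x)

length-filterᵇ : (P : A → Bool) (xs : List A) → length (filterᵇ P xs) ≡ count P xs
length-filterᵇ P []       = refl
length-filterᵇ P (x ∷ xs) with P x
... | true  = cong suc (length-filterᵇ P xs)
... | false = length-filterᵇ P xs

∑-cong : {f g : A → ℕ} → (∀ x → f x ≡ g x) → ∀ xs → ∑ f xs ≡ ∑ g xs
∑-cong f≗g []       = refl
∑-cong f≗g (x ∷ xs) = cong₂ _+_ (f≗g x) (∑-cong f≗g xs)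

∑-zero : {f : A → ℕ} → (∀ x → f x ≡ 0) → ∀ xs → ∑ f xs ≡ 0
∑-zero f≗0 []       = refl
∑-zero f≗0 (x ∷ xs) = cong₂ _+_ (f≗0 x) (∑-zero f≗0 xs)

∑-++ : (f : A → ℕ) (xs ys : List A) → ∑ f (xs ++ ys) ≡ ∑ f xs + ∑ f ys
∑-++ f []       ys = refl
∑-++ f (x ∷ xs) ys = trans (cong (f x +_) (∑-++ f xs ys)) (sym (+-assoc (f x) _ _))

∑-map : (f : B → ℕ) (g : A → B) (xs : List A) → ∑ f (map g xs) ≡ ∑ (f ∘ g) xs
∑-map f g []       = refl
∑-map f g (x ∷ xs) = cong (f (g x) +_) (∑-map f g xs)

∑-concatMap : (f : B → ℕ) (g : A → List B) (xs : List A) →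
              ∑ f (concatMap g xs) ≡ ∑[ x ∈ xs ] ∑ f (g x)
∑-concatMap f g []       = refl
∑-concatMap f g (x ∷ xs) = trans (∑-++ f (g x) (concatMap g xs)) (cong (∑ f (g x) +_) (∑-concatMap f g xs))

∑-distrib-+ : (f g : A → ℕ) (xs : List A) → ∑[ x ∈ xs ] (f x + g x) ≡ ∑ f xs + ∑ g xs
∑-distrib-+ f g []       = refl
∑-distrib-+ f g (x ∷ xs) = begin
  f x + g x + ∑[ y ∈ xs ] (f y + g y)  ≡⟨ cong (f x + g x +_) (∑-distrib-+ f g xs) ⟩
  f x + g x + (∑ f xs + ∑ g xs)        ≡⟨ +-assoc (f x) (g x) _ ⟩
  f x + (g x + (∑ f xs + ∑ g xs))      ≡⟨ cong (f x +_) (sym (+-assoc (g x) _ _)) ⟩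
  f x + (g x + ∑ f xs + ∑ g xs)        ≡⟨ cong (λ t → f x + (t + ∑ g xs)) (+-comm (g x) _) ⟩
  f x + (∑ f xs + g x + ∑ g xs)        ≡⟨ cong (f x +_) (+-assoc (∑ f xs) (g x) _) ⟩
  f x + (∑ f xs + (g x + ∑ g xs))      ≡⟨ sym (+-assoc (f x) _ _) ⟩
  f x + ∑ f xs + (g x + ∑ g xs)        ∎

∑-*ˡ : (c : ℕ) (f : A → ℕ) (xs : List A) → ∑[ x ∈ xs ] (c * f x) ≡ c * ∑ f xs
∑-*ˡ c f []       = sym (*-zeroʳ c)
∑-*ˡ c f (x ∷ xs) = trans (cong (c * f x +_) (∑-*ˡ c f xs)) (sym (*-distribˡ-+ c (f x) _))

∑-comm : (f : A → B → ℕ) (xs : List A) (ys : List B) →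
         ∑[ x ∈ xs ] ∑[ y ∈ ys ] f x y ≡ ∑[ y ∈ ys ] ∑[ x ∈ xs ] f x y
∑-comm f []       ys = sym (∑-zero (λ _ → refl) ys)
∑-comm f (x ∷ xs) ys = trans (cong (∑ (f x) ys +_) (∑-comm f xs ys))
                             (sym (∑-distrib-+ (f x) (λ y → ∑[ x ∈ xs ] f x y) ys))

𝟙-∧ : ∀ b c → 𝟙 (b ∧ c) ≡ 𝟙 b * 𝟙 c
𝟙-∧ true  c = sym (+-identityʳ (𝟙 c))
𝟙-∧ false c = refl

∑-allFin-suc : (f : Fin (suc k) → ℕ) → ∑ f (allFin (suc k)) ≡ f zero + ∑ (f ∘ suc) (allFin k)
∑-allFin-suc {k} f = cong (f zero +_) (begin
  ∑ f (tabulate suc)         ≡⟨ cong (∑ f) (sym (map-tabulate id suc)) ⟩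
  ∑ f (map suc (allFin k))   ≡⟨ ∑-map f suc (allFin k) ⟩
  ∑ (f ∘ suc) (allFin k)     ∎)

𝟙-∧-* : ∀ b c n → 𝟙 (b ∧ c) * n ≡ 𝟙 b * (𝟙 c * n)
𝟙-∧-* b c n = trans (cong (_* n) (𝟙-∧ b c)) (*-assoc (𝟙 b) (𝟙 c) n)

∑-select : (c : Fin k) (g : Fin k → ℕ) → ∑[ i ∈ allFin k ] (𝟙 (i =ᶠ c) * g i) ≡ g c
∑-select {suc k} zero g = begin
  ∑[ i ∈ allFin (suc k) ] (𝟙 (i =ᶠ zero) * g i)  ≡⟨ ∑-allFin-suc (λ i → 𝟙 (i =ᶠ zero) * g i) ⟩
  g zero + 0 + ∑[ i ∈ allFin k ] 0              ≡⟨ cong (g zero + 0 +_) (∑-zero (λ _ → refl) (allFin k)) ⟩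
  g zero + 0 + 0                                ≡⟨ trans (+-identityʳ _) (+-identityʳ _) ⟩
  g zero                                        ∎
∑-select {suc k} (suc c) g = trans (∑-allFin-suc (λ i → 𝟙 (i =ᶠ suc c) * g i)) (∑-select c (g ∘ suc))

∑-allVecs-∷ : (f : Vec (Fin k) (suc N) → ℕ) →
              ∑ f (allVecs (suc N) k) ≡ ∑[ i ∈ allFin k ] ∑[ σ ∈ allVecs N k ] f (i ∷ σ)
∑-allVecs-∷ {k} {N} f = trans (∑-concatMap f (λ i → map (i ∷_) (allVecs N k)) (allFin k))
                              (∑-cong (λ i → ∑-map f (i ∷_) (allVecs N k)) (allFin k))

∑-allVecs-insertAt : (p : Fin (suc N)) (f : Vec (Fin k) (suc N) → ℕ) →
  ∑ f (allVecs (suc N) k) ≡ ∑[ i ∈ allFin k ] ∑[ σ ∈ allVecs N k ] f (insertAt σ p i)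
∑-allVecs-insertAt zero f = ∑-allVecs-∷ f
∑-allVecs-insertAt {suc N} {k} (suc p) f = begin
  ∑ f (allVecs (suc (suc N)) k)
    ≡⟨ ∑-allVecs-∷ f ⟩
  ∑[ i₀ ∈ allFin k ] ∑[ σ ∈ allVecs (suc N) k ] f (i₀ ∷ σ)
    ≡⟨ ∑-cong (λ i₀ → ∑-allVecs-insertAt p (λ σ → f (i₀ ∷ σ))) (allFin k) ⟩
  ∑[ i₀ ∈ allFin k ] ∑[ i ∈ allFin k ] ∑[ σ ∈ allVecs N k ] f (i₀ ∷ insertAt σ p i)
    ≡⟨ ∑-comm (λ i₀ i → ∑[ σ ∈ allVecs N k ] f (i₀ ∷ insertAt σ p i)) (allFin k) (allFin k) ⟩
  ∑[ i ∈ allFin k ] ∑[ i₀ ∈ allFin k ] ∑[ σ ∈ allVecs N k ] f (i₀ ∷ insertAt σ p i)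
    ≡⟨ ∑-cong (λ i → sym (∑-allVecs-∷ (λ σ → f (insertAt σ (suc p) i)))) (allFin k) ⟩
  ∑[ i ∈ allFin k ] ∑[ σ ∈ allVecs (suc N) k ] f (insertAt σ (suc p) i)
    ∎

∑-allVecs-select : (τ : Vec (Fin k) N) (g : Vec (Fin k) N → ℕ) →
                   ∑[ σ ∈ allVecs N k ] (𝟙 (σ =ᵛ τ) * g σ) ≡ g τ
∑-allVecs-select []       g = trans (+-identityʳ _) (+-identityʳ (g []))
∑-allVecs-select {k} {suc N} (c ∷ τ) g = begin
  ∑[ σ ∈ allVecs (suc N) k ] (𝟙 (σ =ᵛ (c ∷ τ)) * g σ)
    ≡⟨ ∑-allVecs-∷ (λ σ → 𝟙 (σ =ᵛ (c ∷ τ)) * g σ) ⟩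
  ∑[ i ∈ allFin k ] ∑[ σ ∈ allVecs N k ] (𝟙 ((i =ᶠ c) ∧ (σ =ᵛ τ)) * g (i ∷ σ))
    ≡⟨ ∑-cong (λ i → ∑-cong (λ σ → 𝟙-∧-* (i =ᶠ c) (σ =ᵛ τ) _) (allVecs N k)) (allFin k) ⟩
  ∑[ i ∈ allFin k ] ∑[ σ ∈ allVecs N k ] (𝟙 (i =ᶠ c) * (𝟙 (σ =ᵛ τ) * g (i ∷ σ)))
    ≡⟨ ∑-cong (λ i → ∑-*ˡ (𝟙 (i =ᶠ c)) _ (allVecs N k)) (allFin k) ⟩
  ∑[ i ∈ allFin k ] (𝟙 (i =ᶠ c) * ∑[ σ ∈ allVecs N k ] (𝟙 (σ =ᵛ τ) * g (i ∷ σ)))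
    ≡⟨ ∑-select c _ ⟩
  ∑[ σ ∈ allVecs N k ] (𝟙 (σ =ᵛ τ) * g (c ∷ σ))
    ≡⟨ ∑-allVecs-select τ (g ∘ (c ∷_)) ⟩
  g (c ∷ τ) ∎

∑-mono-≤ : {f g : A → ℕ} → (∀ x → f x ≤ g x) → ∀ xs → ∑ f xs ≤ ∑ g xs
∑-mono-≤ f≤g []       = z≤n
∑-mono-≤ f≤g (x ∷ xs) = +-mono-≤ (f≤g x) (∑-mono-≤ f≤g xs)

𝟙-*-≤ : ∀ b n → 𝟙 b * n ≤ n
𝟙-*-≤ true  n = ≤-reflexive (+-identityʳ n)
𝟙-*-≤ false n = z≤n

𝟙≤count : (P : Vec (Fin k) N → Bool) (σ : Vec (Fin k) N) → 𝟙 (P σ) ≤ count P (allVecs N k)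
𝟙≤count {k} {N} P σ = subst (_≤ count P (allVecs N k)) (∑-allVecs-select σ (𝟙 ∘ P))
  (∑-mono-≤ (λ τ → 𝟙-*-≤ (τ =ᵛ σ) (𝟙 (P τ))) (allVecs N k))

module _ {k k′ N N′ : ℕ} {P : Vec (Fin k) N → Bool} {Q : Vec (Fin k′) N′ → Bool}
         (f : Vec (Fin k) N → Vec (Fin k′) N′) (g : Vec (Fin k′) N′ → Vec (Fin k) N)
         (f-P→Q : ∀ σ → P σ ≡ true → Q (f σ) ≡ true) (g-Q→P : ∀ τ → Q τ ≡ true → P (g τ) ≡ true)
         (g∘f : ∀ σ → P σ ≡ true → g (f σ) ≡ σ) (f∘g : ∀ τ → Q τ ≡ true → f (g τ) ≡ τ) where

  private
    count-as-graph : ∀ {l l′ M M′} (R : Vec (Fin l) M → Bool) (h : Vec (Fin l) M → Vec (Fin l′) M′) →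
      count R (allVecs M l) ≡ ∑[ σ ∈ allVecs M l ] ∑[ τ ∈ allVecs M′ l′ ] 𝟙 ((τ =ᵛ h σ) ∧ R σ)
    count-as-graph {l} {l′} {M} {M′} R h = ∑-cong (λ σ → begin
      𝟙 (R σ)                                                ≡⟨ sym (∑-allVecs-select (h σ) (λ _ → 𝟙 (R σ))) ⟩
      ∑[ τ ∈ allVecs M′ l′ ] (𝟙 (τ =ᵛ h σ) * 𝟙 (R σ))        ≡⟨ ∑-cong (λ τ → sym (𝟙-∧ (τ =ᵛ h σ) (R σ))) (allVecs M′ l′) ⟩
      ∑[ τ ∈ allVecs M′ l′ ] 𝟙 ((τ =ᵛ h σ) ∧ R σ)            ∎) (allVecs M l)

    graph-transpose : ∀ σ τ → (τ =ᵛ f σ) ∧ P σ ≡ (σ =ᵛ g τ) ∧ Q τ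
    graph-transpose σ τ = ⇔→≡ {z = true} (mk⇔ to from)
      where
      to : (τ =ᵛ f σ) ∧ P σ ≡ true → (σ =ᵛ g τ) ∧ Q τ ≡ true
      to e with ∧-true e
      ... | τ=fσ , Pσ with refl ← does⇒ (≡-dec _≟_ τ (f σ)) τ=fσ
        rewrite g∘f σ Pσ | =ᵛ-refl σ = f-P→Q σ Pσ
      from : (σ =ᵛ g τ) ∧ Q τ ≡ true → (τ =ᵛ f σ) ∧ P σ ≡ true
      from e with ∧-true e
      ... | σ=gτ , Qτ with refl ← does⇒ (≡-dec _≟_ σ (g τ)) σ=gτ
        rewrite f∘g τ Qτ | =ᵛ-refl τ = g-Q→P τ Qτ

  count-bijection : count P (allVecs N k) ≡ count Q (allVecs N′ k′)
  count-bijection = begin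
    count P (allVecs N k)
      ≡⟨ count-as-graph P f ⟩
    ∑[ σ ∈ allVecs N k ] ∑[ τ ∈ allVecs N′ k′ ] 𝟙 ((τ =ᵛ f σ) ∧ P σ)
      ≡⟨ ∑-cong (λ σ → ∑-cong (λ τ → cong 𝟙 (graph-transpose σ τ)) (allVecs N′ k′)) (allVecs N k) ⟩
    ∑[ σ ∈ allVecs N k ] ∑[ τ ∈ allVecs N′ k′ ] 𝟙 ((σ =ᵛ g τ) ∧ Q τ)
      ≡⟨ ∑-comm (λ σ τ → 𝟙 ((σ =ᵛ g τ) ∧ Q τ)) (allVecs N k) (allVecs N′ k′) ⟩
    ∑[ τ ∈ allVecs N′ k′ ] ∑[ σ ∈ allVecs N k ] 𝟙 ((σ =ᵛ g τ) ∧ Q τ)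
      ≡⟨ sym (count-as-graph Q g) ⟩
    count Q (allVecs N′ k′) ∎

count≡0⇒false : {R : Vec (Fin k) N → Bool} → count R (allVecs N k) ≡ 0 → ∀ σ → R σ ≡ false
count≡0⇒false {R = R} none σ with R σ | 𝟙≤count R σ
... | false | _   = refl
... | true  | 1≤# = contradiction (subst (1 ≤_) none 1≤#) λ ()

count-≡⇒⊇ : {P Q : Vec (Fin k) N → Bool} → (∀ σ → P σ ≡ true → Q σ ≡ true) →
            count P (allVecs N k) ≡ count Q (allVecs N k) → ∀ σ → Q σ ≡ true → P σ ≡ true
count-≡⇒⊇ {k} {N} {P} {Q} P⊆Q same σ Qσ with P σ in Pσ
... | true  = refl
... | false = contradiction (trans (cong₂ (λ q p → q ∧ not p) (sym Qσ) (sym Pσ)) (count≡0⇒false Q∖P-empty σ)) λ ()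
  where
  Q∖P : Vec (Fin k) N → Bool
  Q∖P τ = Q τ ∧ not (P τ)
  split : ∀ τ → 𝟙 (Q τ) ≡ 𝟙 (P τ) + 𝟙 (Q∖P τ)
  split τ with P τ in Pτ | Q τ in Qτ
  ... | true  | true  = refl
  ... | true  | false = contradiction (trans (sym (P⊆Q τ Pτ)) Qτ) λ ()
  ... | false | q     = cong 𝟙 (sym (∧-identityʳ q))
  Q∖P-empty : count Q∖P (allVecs N k) ≡ 0
  Q∖P-empty = +-cancelˡ-≡ (count P (allVecs N k)) _ 0 (begin
    count P (allVecs N k) + count Q∖P (allVecs N k)  ≡⟨ sym (∑-distrib-+ (𝟙 ∘ P) (𝟙 ∘ Q∖P) (allVecs N k)) ⟩
    ∑[ τ ∈ allVecs N k ] (𝟙 (P τ) + 𝟙 (Q∖P τ))       ≡⟨ sym (∑-cong split (allVecs N k)) ⟩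
    count Q (allVecs N k)                            ≡⟨ sym same ⟩
    count P (allVecs N k)                            ≡⟨ sym (+-identityʳ _) ⟩
    count P (allVecs N k) + 0                        ∎)

parity≡0ℙ⇒Even : ∀ m → parity m ≡ 0ℙ → Even m
parity≡0ℙ⇒Even zero          _ = 0 , refl
parity≡0ℙ⇒Even (suc zero)    ()
parity≡0ℙ⇒Even (suc (suc m)) e with parity≡0ℙ⇒Even m e
... | j , refl = suc j , sym (*-suc 2 j)

infix 4 _≡ₚ_or_

data _≡ₚ_or_ (m n : ℕ) (E : Set) : Set where
  agree : parity m ≡ parity n → m ≡ₚ n or E
  found : E → m ≡ₚ n or E

≡ₚ-or-∑ : {E : Set} {f g : A → ℕ} → (∀ x → f x ≡ₚ g x or E) → ∀ xs → ∑ f xs ≡ₚ ∑ g xs or E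
≡ₚ-or-∑ match [] = agree refl
≡ₚ-or-∑ {f = f} {g} match (x ∷ xs) with match x | ≡ₚ-or-∑ match xs
... | found e | _       = found e
... | agree _ | found e = found e
... | agree p | agree q = agree (begin
  parity (f x + ∑ f xs)            ≡⟨ ℙ.+-homo-+ (f x) (∑ f xs) ⟩
  parity (f x) +ℙ parity (∑ f xs)  ≡⟨ cong₂ _+ℙ_ p q ⟩
  parity (g x) +ℙ parity (∑ g xs)  ≡⟨ ℙ.+-homo-+ (g x) (∑ g xs) ⟨
  parity (g x + ∑ g xs)            ∎)

≡ₚ-or-𝟙* : {P E : Set} (P? : Dec P) {m n : ℕ} → (P → m ≡ₚ n or E) → 𝟙 (does P?) * m ≡ₚ 𝟙 (does P?) * n or E
≡ₚ-or-𝟙* (no _)  _ = agree refl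
≡ₚ-or-𝟙* (yes p) {m} {n} match with match p
... | found e = found e
... | agree q = agree (trans (cong parity (+-identityʳ m)) (trans q (cong parity (sym (+-identityʳ n)))))

parity-cancelʳ : ∀ m m′ s s′ → parity (m + s) ≡ parity (m′ + s′) → parity s ≡ parity s′ → parity m ≡ parity m′
parity-cancelʳ m m′ s s′ total rest = ℙ.+-cancelʳ-≡ (parity s) (parity m) (parity m′) (begin
  parity m +ℙ parity s    ≡⟨ ℙ.+-homo-+ m s ⟨
  parity (m + s)          ≡⟨ total ⟩
  parity (m′ + s′)        ≡⟨ ℙ.+-homo-+ m′ s′ ⟩
  parity m′ +ℙ parity s′  ≡⟨ cong (parity m′ +ℙ_) rest ⟨
  parity m′ +ℙ parity s   ∎)

_<ˡᵉˣ_ : Vec (Fin k) N → Vec (Fin k) N → Set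
_<ˡᵉˣ_ = Lex.Lex-< _≡_ _<ᶠ_

_<ˡᵉˣ?_ : (σ τ : Vec (Fin k) N) → Dec (σ <ˡᵉˣ τ)
_<ˡᵉˣ?_ = Lex.<-decidable _≟_ _<ᶠ?_

<ˡᵉˣ-cmp : (σ τ : Vec (Fin k) N) → Tri (σ <ˡᵉˣ τ) (σ ≡ τ) (τ <ˡᵉˣ σ)
<ˡᵉˣ-cmp σ τ with Lex.<-cmp sym <ᶠ-cmp σ τ
... | tri< σ<τ σ≉τ τ≮σ = tri< σ<τ (σ≉τ ∘ ≡⇒Pointwise-≡) τ≮σ
... | tri≈ σ≮τ σ≈τ τ≮σ = tri≈ σ≮τ (Pointwise-≡⇒≡ σ≈τ) τ≮σ
... | tri> σ≮τ σ≉τ τ<σ = tri> σ≮τ (σ≉τ ∘ ≡⇒Pointwise-≡) τ<σ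

module _ {N k : ℕ} {P : Vec (Fin k) N → Bool} (ι : Vec (Fin k) N → Vec (Fin k) N)
         (ι-closed : ∀ σ → P σ ≡ true → P (ι σ) ≡ true) (ι-involutive : ∀ σ → P σ ≡ true → ι (ι σ) ≡ σ) where

  private
    Fixed Lowered Raised : Vec (Fin k) N → Bool
    Fixed   σ = P σ ∧ (ι σ =ᵛ σ)
    Lowered σ = P σ ∧ does (ι σ <ˡᵉˣ? σ)
    Raised  σ = P σ ∧ does (σ <ˡᵉˣ? ι σ)

    trichotomy : ∀ σ → 𝟙 (P σ) ≡ 𝟙 (Fixed σ) + (𝟙 (Lowered σ) + 𝟙 (Raised σ))
    trichotomy σ with P σ
    ... | false = refl
    ... | true with <ˡᵉˣ-cmp (ι σ) σ
    ...   | tri< ισ<σ ισ≢σ σ≮ισ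
      rewrite dec-false (≡-dec _≟_ (ι σ) σ) ισ≢σ | dec-true (ι σ <ˡᵉˣ? σ) ισ<σ | dec-false (σ <ˡᵉˣ? ι σ) σ≮ισ = refl
    ...   | tri≈ ισ≮σ ισ≡σ σ≮ισ
      rewrite dec-true (≡-dec _≟_ (ι σ) σ) ισ≡σ | dec-false (ι σ <ˡᵉˣ? σ) ισ≮σ | dec-false (σ <ˡᵉˣ? ι σ) σ≮ισ = refl
    ...   | tri> ισ≮σ ισ≢σ σ<ισ
      rewrite dec-false (≡-dec _≟_ (ι σ) σ) ισ≢σ | dec-false (ι σ <ˡᵉˣ? σ) ισ≮σ | dec-true (σ <ˡᵉˣ? ι σ) σ<ισ = refl

    swap : ∀ σ → Lowered σ ≡ true → Raised (ι σ) ≡ true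
    swap σ e with ∧-true e
    ... | Pσ , lowered rewrite ι-involutive σ Pσ | ι-closed σ Pσ = lowered

    unswap : ∀ σ → Raised σ ≡ true → Lowered (ι σ) ≡ true
    unswap σ e with ∧-true e
    ... | Pσ , raised rewrite ι-involutive σ Pσ | ι-closed σ Pσ = raised

  -- ι swaps the points it moves down in the lexicographic order with those it moves up.
  involution-parity : parity (count P (allVecs N k)) ≡ parity (count (λ σ → P σ ∧ (ι σ =ᵛ σ)) (allVecs N k))
  involution-parity = begin
    parity (count P L)                                      ≡⟨ cong parity (∑-cong trichotomy L) ⟩
    parity (∑[ σ ∈ L ] (𝟙 (Fixed σ) + (𝟙 (Lowered σ) + 𝟙 (Raised σ))))
      ≡⟨ cong parity (trans (∑-distrib-+ _ _ L) (cong (count Fixed L +_) (∑-distrib-+ _ _ L))) ⟩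
    parity (count Fixed L + (count Lowered L + count Raised L))
      ≡⟨ cong (λ r → parity (count Fixed L + (count Lowered L + r))) (sym lowered≡raised) ⟩
    parity (count Fixed L + (count Lowered L + count Lowered L))
      ≡⟨ ℙ.+-homo-+ (count Fixed L) _ ⟩
    parity (count Fixed L) +ℙ parity (count Lowered L + count Lowered L)
      ≡⟨ cong (parity (count Fixed L) +ℙ_) (trans (ℙ.+-homo-+ (count Lowered L) _) (ℙ.p+p≡0ℙ (parity (count Lowered L)))) ⟩
    parity (count Fixed L) +ℙ 0ℙ
      ≡⟨ ℙ.+-identityʳ _ ⟩
    parity (count Fixed L) ∎
    where
    L : List (Vec (Fin k) N)
    L = allVecs N k
    lowered≡raised : count Lowered L ≡ count Raised L
    lowered≡raised = count-bijection ι ι swap unswap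
      (λ σ e → ι-involutive σ (proj₁ (∧-true e))) (λ σ e → ι-involutive σ (proj₁ (∧-true e)))

-- Homomorphisms and partial injectivity

Preserves : (G T : Graph) → (Vertex G → Vertex T) → Set
Preserves G T f = ∀ u v → Edge G u v → Edge T (f u) (f v)

record IsHom (G T : Graph) (w x : Vertex G) (a b : Vertex T) (σ : Vec (Vertex T) (n G)) : Set where
  constructor isHom
  field
    maps-w    : lookup σ w ≡ a
    maps-x    : lookup σ x ≡ b
    preserves : Preserves G T (lookup σ)

module _ {G T : Graph} {w x : Vertex G} {a b : Vertex T} {σ : Vec (Vertex T) (n G)} where

  isHomᵇ-sound : isHomᵇ G T w x a b σ ≡ true → IsHom G T w x a b σ
  isHomᵇ-sound e with ∧-true {⌊ lookup σ w ≟ a ⌋} e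
  ... | σw≡a , e′ with ∧-true {⌊ lookup σ x ≟ b ⌋} e′
  ... | σx≡b , edges = isHom (⌊⌋⇒ (lookup σ w ≟ a) σw≡a) (⌊⌋⇒ (lookup σ x ≟ b) σx≡b) preserves
    where
    preserves : Preserves G T (lookup σ)
    preserves u v uv with adj G u v | and-allPairs-true edges u v
    ... | true | σuσv = σuσv

  isHomᵇ-complete : IsHom G T w x a b σ → isHomᵇ G T w x a b σ ≡ true
  isHomᵇ-complete (isHom σw≡a σx≡b preserves) = ¬-not refute
    where
    refute : isHomᵇ G T w x a b σ ≢ false
    refute e with ∧-false {⌊ lookup σ w ≟ a ⌋} e
    ... | inj₁ σw≢a = contradiction (trans (sym (⌊⌋-yes _ σw≡a)) σw≢a) λ ()
    ... | inj₂ e′ with ∧-false {⌊ lookup σ x ≟ b ⌋} e′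
    ... | inj₁ σx≢b = contradiction (trans (sym (⌊⌋-yes _ σx≡b)) σx≢b) λ ()
    ... | inj₂ edges with and-allPairs-false edges
    -- `fails` mentions the implication test local to isHomᵇ; abstracting `adj G u v` evaluates it
    ... | u , v , fails with adj G u v | fails | preserves u v
    ...   | false | ()     | _
    ...   | true  | fails′ | σuσv = contradiction (trans (sym (σuσv refl)) fails′) λ ()

isHomᵇ-≡ : {G G′ T T′ : Graph} {w x : Vertex G} {w′ x′ : Vertex G′} {a b : Vertex T} {a′ b′ : Vertex T′}
           {σ : Vec (Vertex T) (n G)} {σ′ : Vec (Vertex T′) (n G′)} →
           (IsHom G T w x a b σ → IsHom G′ T′ w′ x′ a′ b′ σ′) → (IsHom G′ T′ w′ x′ a′ b′ σ′ → IsHom G T w x a b σ) →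
           isHomᵇ G T w x a b σ ≡ isHomᵇ G′ T′ w′ x′ a′ b′ σ′
isHomᵇ-≡ to from = ⇔→≡ {z = true} (mk⇔ (isHomᵇ-complete ∘ to ∘ isHomᵇ-sound) (isHomᵇ-complete ∘ from ∘ isHomᵇ-sound))

InjectiveBelow : ℕ → (Fin N → A) → Set
InjectiveBelow j f = ∀ p q → toℕ p < j → toℕ q < j → f p ≡ f q → p ≡ q

injectiveBelow? : (j : ℕ) (f : Fin N → Fin k) → Dec (InjectiveBelow j f)
injectiveBelow? j f = all? λ p → all? λ q →
  (toℕ p <? j) →-dec ((toℕ q <? j) →-dec ((f p ≟ f q) →-dec (p ≟ q)))

injBelowᵇ : ℕ → Vec (Fin k) N → Bool
injBelowᵇ j σ = does (injectiveBelow? j (lookup σ))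

injectiveBelow-pred : ∀ {j} {f : Fin N → A} → InjectiveBelow (suc j) f → InjectiveBelow j f
injectiveBelow-pred inj p q p<j q<j = inj p q (≤-trans p<j (n≤1+n _)) (≤-trans q<j (n≤1+n _))

module _ {f : Fin N → Fin k} (j : Fin N) (inj : InjectiveBelow (toℕ j) f) where

  private
    collides? : (u : Fin N) → Dec (toℕ u < toℕ j × f u ≡ f j)
    collides? u = (toℕ u <? toℕ j) ×-dec (f u ≟ f j)

    collision-summand : ∀ u → 𝟙 (does (toℕ u <? toℕ j)) * 𝟙 (f u =ᶠ f j) ≡ 𝟙 (does (collides? u))
    collision-summand u = sym (𝟙-∧ (does (toℕ u <? toℕ j)) (f u =ᶠ f j))

    extend : (∀ u → ¬ (toℕ u < toℕ j × f u ≡ f j)) → InjectiveBelow (suc (toℕ j)) f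
    extend none p q p≤j q≤j fp≡fq with m<1+n⇒m<n∨m≡n p≤j | m<1+n⇒m<n∨m≡n q≤j
    ... | inj₁ p<j | inj₁ q<j = inj p q p<j q<j fp≡fq
    ... | inj₁ p<j | inj₂ q=j = contradiction (p<j , trans fp≡fq (cong f (toℕ-injective q=j))) (none p)
    ... | inj₂ p=j | inj₁ q<j = contradiction (q<j , trans (sym fp≡fq) (cong f (toℕ-injective p=j))) (none q)
    ... | inj₂ p=j | inj₂ q=j = toℕ-injective (trans p=j (sym q=j))

  injectiveBelow-suc-split :
    𝟙 (does (injectiveBelow? (suc (toℕ j)) f)) + ∑[ u ∈ allFin N ] (𝟙 (does (toℕ u <? toℕ j)) * 𝟙 (f u =ᶠ f j)) ≡ 1
  injectiveBelow-suc-split with any? collides?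
  ... | no none = cong₂ _+_ (cong 𝟙 (dec-true (injectiveBelow? (suc (toℕ j)) f) (extend (λ u c → none (u , c)))))
                            (trans (∑-cong collision-summand (allFin N))
                                   (∑-zero (λ u → cong 𝟙 (dec-false (collides? u) (λ c → none (u , c)))) (allFin N)))
  ... | yes (u₀ , u₀<j , fu₀≡fj) = cong₂ _+_ (cong 𝟙 (dec-false (injectiveBelow? (suc (toℕ j)) f) j-collides)) (begin
      ∑[ u ∈ allFin N ] (𝟙 (does (toℕ u <? toℕ j)) * 𝟙 (f u =ᶠ f j))
        ≡⟨ ∑-cong (λ u → trans (collision-summand u) (collides⇔u₀ u)) (allFin N) ⟩
      ∑[ u ∈ allFin N ] (𝟙 (u =ᶠ u₀) * 1)
        ≡⟨ ∑-select u₀ (λ _ → 1) ⟩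
      1 ∎)
    where
    j-collides : ¬ InjectiveBelow (suc (toℕ j)) f
    j-collides inj′ with inj′ u₀ j (≤-trans u₀<j (n≤1+n (toℕ j))) ≤-refl fu₀≡fj
    ... | refl = <-irrefl refl u₀<j
    collides⇔u₀ : ∀ u → 𝟙 (does (collides? u)) ≡ 𝟙 (u =ᶠ u₀) * 1
    collides⇔u₀ u = trans (cong 𝟙 (does-⇔ (mk⇔ (λ (u<j , fu≡fj) → inj u u₀ u<j u₀<j (trans fu≡fj (sym fu₀≡fj)))
                                                (λ { refl → u₀<j , fu₀≡fj }))
                                          (collides? u) (u ≟ u₀)))
                          (sym (*-identityʳ _))

module _ {N k : ℕ} (h : Vec (Fin k) N → Bool) where

  injCount : ℕ → ℕ
  injCount i = count (λ σ → h σ ∧ injBelowᵇ i σ) (allVecs N k)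

  collisionCount : Fin N → Fin N → ℕ
  collisionCount j u = count (λ σ → (h σ ∧ injBelowᵇ (toℕ j) σ) ∧ (lookup σ u =ᶠ lookup σ j)) (allVecs N k)

  private
    earlier : Fin N → Fin N → ℕ
    earlier j u = 𝟙 (does (toℕ u <? toℕ j))

    no-collisions : ∀ j → ∑[ u ∈ allFin N ] (earlier j u * 𝟙 false) ≡ 0
    no-collisions j = ∑-zero (λ u → *-zeroʳ (earlier j u)) (allFin N)

    injCount-split : ∀ j σ →
      𝟙 (h σ ∧ injBelowᵇ (toℕ j) σ) ≡
      𝟙 (h σ ∧ injBelowᵇ (suc (toℕ j)) σ) +
      ∑[ u ∈ allFin N ] (earlier j u * 𝟙 ((h σ ∧ injBelowᵇ (toℕ j) σ) ∧ (lookup σ u =ᶠ lookup σ j)))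
    injCount-split j σ with h σ | injBelowᵇ (toℕ j) σ in inj?
    ... | false | _     = sym (no-collisions j)
    ... | true  | false = sym (cong₂ _+_ (cong 𝟙 (dec-false (injectiveBelow? (suc (toℕ j)) (lookup σ)) not-inj))
                                         (no-collisions j))
      where
      not-inj : ¬ InjectiveBelow (suc (toℕ j)) (lookup σ)
      not-inj inj = contradiction
        (trans (sym (dec-true (injectiveBelow? (toℕ j) (lookup σ)) (injectiveBelow-pred inj))) inj?) λ ()
    ... | true  | true  = sym (injectiveBelow-suc-split j (does⇒ (injectiveBelow? (toℕ j) (lookup σ)) inj?))

  injCount-suc : (j : Fin N) →
    injCount (toℕ j) ≡ injCount (suc (toℕ j)) + ∑[ u ∈ allFin N ] (𝟙 (does (toℕ u <? toℕ j)) * collisionCount j u)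
  injCount-suc j = begin
    injCount (toℕ j)
      ≡⟨ ∑-cong (injCount-split j) (allVecs N k) ⟩
    ∑[ σ ∈ allVecs N k ] (𝟙 (h σ ∧ injBelowᵇ (suc (toℕ j)) σ) + ∑[ u ∈ allFin N ] (earlier j u * 𝟙 (C u σ)))
      ≡⟨ ∑-distrib-+ _ _ (allVecs N k) ⟩
    injCount (suc (toℕ j)) + ∑[ σ ∈ allVecs N k ] ∑[ u ∈ allFin N ] (earlier j u * 𝟙 (C u σ))
      ≡⟨ cong (injCount (suc (toℕ j)) +_) (∑-comm (λ σ u → earlier j u * 𝟙 (C u σ)) (allVecs N k) (allFin N)) ⟩
    injCount (suc (toℕ j)) + ∑[ u ∈ allFin N ] ∑[ σ ∈ allVecs N k ] (earlier j u * 𝟙 (C u σ))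
      ≡⟨ cong (injCount (suc (toℕ j)) +_) (∑-cong (λ u → ∑-*ˡ (earlier j u) (𝟙 ∘ C u) (allVecs N k)) (allFin N)) ⟩
    injCount (suc (toℕ j)) + ∑[ u ∈ allFin N ] (earlier j u * collisionCount j u)
      ∎
    where
    C : Fin N → Vec (Fin k) N → Bool
    C u σ = (h σ ∧ injBelowᵇ (toℕ j) σ) ∧ (lookup σ u =ᶠ lookup σ j)

injectiveBelow⇒injective : {f : Fin N → A} → InjectiveBelow N f → Injective _≡_ _≡_ f
injectiveBelow⇒injective inj {p} {q} = inj p q (toℕ<n p) (toℕ<n q)

injective⇒injectiveBelow : ∀ {j} {f : Fin N → A} → Injective _≡_ _≡_ f → InjectiveBelow j f
injective⇒injectiveBelow inj _ _ _ _ = inj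

-- Contracting a vertex

punchIn-view : (j p : Fin (suc N)) → p ≡ j ⊎ ∃ λ i → p ≡ punchIn j i
punchIn-view j p with p ≟ j
... | yes p≡j = inj₁ p≡j
... | no  p≢j = inj₂ (punchOut (p≢j ∘ sym) , sym (punchIn-punchOut (p≢j ∘ sym)))

toℕ-punchIn-below : (j : Fin (suc N)) (i : Fin N) → toℕ i < toℕ j → toℕ (punchIn j i) ≡ toℕ i
toℕ-punchIn-below (suc j) zero    _         = refl
toℕ-punchIn-below (suc j) (suc i) (s≤s i<j) = cong suc (toℕ-punchIn-below j i i<j)

toℕ-punchIn-below′ : (j : Fin (suc N)) (i : Fin N) → toℕ (punchIn j i) < toℕ j → toℕ (punchIn j i) ≡ toℕ i
toℕ-punchIn-below′ (suc j) zero    _         = refl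
toℕ-punchIn-below′ (suc j) (suc i) (s≤s i<j) = cong suc (toℕ-punchIn-below′ j i i<j)

module Contraction {N′ : ℕ} (A : Fin (suc N′) → Fin (suc N′) → Bool)
                   (A-sym : ∀ p q → A p q ≡ A q p) (A-irrefl : ∀ p → A p p ≡ false)
                   (j : Fin (suc N′)) (u : Fin N′) (j≁u : A j (punchIn j u) ≡ false) where

  G : Graph
  G = record { n = suc N′ ; adj = A ; sym = A-sym ; irrefl = A-irrefl }

  collapse : Fin (suc N′) → Fin N′
  collapse p with p ≟ j
  ... | yes _   = u
  ... | no  p≢j = punchOut (p≢j ∘ sym)

  collapse-j : collapse j ≡ u
  collapse-j with j ≟ j
  ... | yes _   = refl
  ... | no  j≢j = contradiction refl j≢j

  collapse-punchIn : ∀ i → collapse (punchIn j i) ≡ i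
  collapse-punchIn i with punchIn j i ≟ j
  ... | yes j≡ = contradiction j≡ (punchInᵢ≢i j i)
  ... | no  _  = trans (punchOut-cong j refl) (punchOut-punchIn j)

  -- j is merged into punchIn j u; the vertices of the contraction are numbered by punchOut
  A′ : Fin N′ → Fin N′ → Bool
  A′ i k = A (punchIn j i) (punchIn j k) ∨ ((i =ᶠ u) ∧ A j (punchIn j k)) ∨ ((k =ᶠ u) ∧ A j (punchIn j i))

  A′-sym : ∀ i k → A′ i k ≡ A′ k i
  A′-sym i k rewrite A-sym (punchIn j i) (punchIn j k) =
    cong (A (punchIn j k) (punchIn j i) ∨_) (∨-comm ((i =ᶠ u) ∧ A j (punchIn j k)) _)

  A′-irrefl : ∀ i → A′ i i ≡ false
  A′-irrefl i rewrite A-irrefl (punchIn j i) with i ≟ u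
  ... | yes refl rewrite j≁u = refl
  ... | no  _    = refl

  G/ : Graph
  G/ = record { n = N′ ; adj = A′ ; sym = A′-sym ; irrefl = A′-irrefl }

  collapse-preserves : ∀ p q → A p q ≡ true → A′ (collapse p) (collapse q) ≡ true
  collapse-preserves p q pq with punchIn-view j p | punchIn-view j q
  ... | inj₁ refl | inj₁ refl = contradiction (trans (sym pq) (A-irrefl j)) λ ()
  ... | inj₁ refl | inj₂ (k , refl)
    rewrite collapse-j | collapse-punchIn k | dec-true (u ≟ u) refl | pq =
        ∨-zeroʳ (A (punchIn j u) (punchIn j k))
  ... | inj₂ (i , refl) | inj₁ refl
    rewrite collapse-j | collapse-punchIn i | dec-true (u ≟ u) refl | A-sym (punchIn j i) j | pq =
        trans (cong (A (punchIn j i) (punchIn j u) ∨_) (∨-zeroʳ _)) (∨-zeroʳ _)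
  ... | inj₂ (i , refl) | inj₂ (k , refl) rewrite collapse-punchIn i | collapse-punchIn k | pq = refl

  lift-edge : ∀ i k → A′ i k ≡ true → ∃₂ λ p q → collapse p ≡ i × collapse q ≡ k × A p q ≡ true
  lift-edge i k e with ∨-true e
  ... | inj₁ e₁ = punchIn j i , punchIn j k , collapse-punchIn i , collapse-punchIn k , e₁
  ... | inj₂ e₂ with ∨-true e₂
  ... | inj₁ e₃ with does⇒ (i ≟ u) (proj₁ (∧-true e₃))
  ...   | refl = j , punchIn j k , collapse-j , collapse-punchIn k , proj₂ (∧-true e₃)
  lift-edge i k e | inj₂ e₂ | inj₂ e₄ with does⇒ (k ≟ u) (proj₁ (∧-true e₄))
  ...   | refl = punchIn j i , j , collapse-punchIn i , collapse-j , trans (A-sym _ j) (proj₂ (∧-true e₄))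

  collapse-walk : ∀ {p q} → Walk G p q → Walk G/ (collapse p) (collapse q)
  collapse-walk []          = []
  collapse-walk (pq ∷ walk) = collapse-preserves _ _ pq ∷ collapse-walk walk

  G/-connected : Connected G → Connected G/
  G/-connected connected i k =
    subst₂ (Walk G/) (collapse-punchIn i) (collapse-punchIn k) (collapse-walk (connected (punchIn j i) (punchIn j k)))

  G/-bipartite : ((side , side-ok) : Bipartite G) → side (punchIn j u) ≡ side j → Bipartite G/
  G/-bipartite (side , side-ok) same = side ∘ punchIn j , λ i k ik → case lift-edge i k ik of λ where
      (p , q , refl , refl , pq) eq → side-ok p q pq (trans (sym (side-collapse p)) (trans eq (side-collapse q)))
    where
    side-collapse : ∀ p → side (punchIn j (collapse p)) ≡ side p
    side-collapse p with punchIn-view j p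
    ... | inj₁ refl       = trans (cong (side ∘ punchIn j) collapse-j) same
    ... | inj₂ (i , refl) = cong (side ∘ punchIn j) (collapse-punchIn i)

  expand : Vec (Fin k) N′ → Vec (Fin k) (suc N′)
  expand σ′ = insertAt σ′ j (lookup σ′ u)

  lookup-expand : (σ′ : Vec (Fin k) N′) (p : Fin (suc N′)) → lookup (expand σ′) p ≡ lookup σ′ (collapse p)
  lookup-expand σ′ p with punchIn-view j p
  ... | inj₁ refl       = trans (insertAt-lookup σ′ j _) (cong (lookup σ′) (sym collapse-j))
  ... | inj₂ (i , refl) = trans (insertAt-punchIn σ′ j _ i) (cong (lookup σ′) (sym (collapse-punchIn i)))

  lookup-expand-punchIn : (σ′ : Vec (Fin k) N′) (i : Fin N′) → lookup (expand σ′) (punchIn j i) ≡ lookup σ′ i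
  lookup-expand-punchIn σ′ i = trans (lookup-expand σ′ (punchIn j i)) (cong (lookup σ′) (collapse-punchIn i))

  module _ (T : Graph) (w x : Vertex G) (a b : Vertex T) (σ′ : Vec (Vertex T) N′) where

    expand-hom : IsHom G/ T (collapse w) (collapse x) a b σ′ → IsHom G T w x a b (expand σ′)
    expand-hom (isHom σw≡a σx≡b preserves) = isHom
      (trans (lookup-expand σ′ w) σw≡a) (trans (lookup-expand σ′ x) σx≡b)
      λ p q pq → subst₂ (Edge T) (sym (lookup-expand σ′ p)) (sym (lookup-expand σ′ q))
                        (preserves _ _ (collapse-preserves p q pq))

    contract-hom : IsHom G T w x a b (expand σ′) → IsHom G/ T (collapse w) (collapse x) a b σ′
    contract-hom (isHom σw≡a σx≡b preserves) =
      isHom (trans (sym (lookup-expand σ′ w)) σw≡a) (trans (sym (lookup-expand σ′ x)) σx≡b) preserves′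
      where
      preserves′ : Preserves G/ T (lookup σ′)
      preserves′ i k ik with lift-edge i k ik
      ... | p , q , refl , refl , pq = subst₂ (Edge T) (lookup-expand σ′ p) (lookup-expand σ′ q) (preserves p q pq)

  collapse-below : ∀ p → toℕ p < toℕ j → punchIn j (collapse p) ≡ p × toℕ (collapse p) ≡ toℕ p
  collapse-below p p<j with punchIn-view j p
  ... | inj₁ refl       = contradiction p<j (<-irrefl refl)
  ... | inj₂ (i , refl) rewrite collapse-punchIn i = refl , sym (toℕ-punchIn-below′ j i p<j)

  module _ {k : ℕ} (σ′ : Vec (Fin k) N′) where

    expand-injectiveBelow : InjectiveBelow (toℕ j) (lookup σ′) → InjectiveBelow (toℕ j) (lookup (expand σ′))
    expand-injectiveBelow inj p q p<j q<j σp≡σq with collapse-below p p<j | collapse-below q q<j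
    ... | p≡ , toℕp | q≡ , toℕq = trans (sym p≡) (trans (cong (punchIn j) collapse-p≡q) q≡)
      where
      collapse-p≡q : collapse p ≡ collapse q
      collapse-p≡q = inj (collapse p) (collapse q) (subst (_< toℕ j) (sym toℕp) p<j) (subst (_< toℕ j) (sym toℕq) q<j)
        (trans (sym (lookup-expand σ′ p)) (trans σp≡σq (lookup-expand σ′ q)))

    contract-injectiveBelow : InjectiveBelow (toℕ j) (lookup (expand σ′)) → InjectiveBelow (toℕ j) (lookup σ′)
    contract-injectiveBelow inj i k i<j k<j σi≡σk =
      punchIn-injective j i k (inj (punchIn j i) (punchIn j k) (below i i<j) (below k k<j)
        (trans (lookup-expand-punchIn σ′ i) (trans σi≡σk (sym (lookup-expand-punchIn σ′ k)))))
      where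
      below : ∀ i → toℕ i < toℕ j → toℕ (punchIn j i) < toℕ j
      below i i<j = subst (_< toℕ j) (sym (toℕ-punchIn-below j i i<j)) i<j

  module _ (T : Graph) (w x : Vertex G) (a b : Vertex T) where

    private
      h : Vec (Vertex T) (suc N′) → Bool
      h σ = isHomᵇ G T w x a b σ ∧ injBelowᵇ (toℕ j) σ

      h/ : Vec (Vertex T) N′ → Bool
      h/ σ′ = isHomᵇ G/ T (collapse w) (collapse x) a b σ′ ∧ injBelowᵇ (toℕ j) σ′

      h-expand : ∀ σ′ → h (expand σ′) ≡ h/ σ′
      h-expand σ′ = cong₂ _∧_ (isHomᵇ-≡ (contract-hom T w x a b σ′) (expand-hom T w x a b σ′))
                              (does-⇔ (mk⇔ (contract-injectiveBelow σ′) (expand-injectiveBelow σ′))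
                                      (injectiveBelow? (toℕ j) (lookup (expand σ′))) (injectiveBelow? (toℕ j) (lookup σ′)))

      h-collides : Vec (Vertex T) (suc N′) → Bool
      h-collides σ = h σ ∧ (lookup σ (punchIn j u) =ᶠ lookup σ j)

      h-collides-insertAt : ∀ i σ′ → 𝟙 (h-collides (insertAt σ′ j i)) ≡ 𝟙 (i =ᶠ lookup σ′ u) * 𝟙 (h (insertAt σ′ j i))
      h-collides-insertAt i σ′ rewrite insertAt-punchIn σ′ j i u | insertAt-lookup σ′ j i | =ᶠ-sym (lookup σ′ u) i =
        trans (𝟙-∧ (h (insertAt σ′ j i)) (i =ᶠ lookup σ′ u)) (*-comm (𝟙 (h (insertAt σ′ j i))) _)

    collisionCount-contraction :
      collisionCount (isHomᵇ G T w x a b) j (punchIn j u) ≡ injCount (isHomᵇ G/ T (collapse w) (collapse x) a b) (toℕ j)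
    collisionCount-contraction = begin
      count h-collides (allVecs (suc N′) (n T))
        ≡⟨ ∑-allVecs-insertAt j (𝟙 ∘ h-collides) ⟩
      ∑[ i ∈ allFin (n T) ] ∑[ σ′ ∈ allVecs N′ (n T) ] 𝟙 (h-collides (insertAt σ′ j i))
        ≡⟨ ∑-cong (λ i → ∑-cong (h-collides-insertAt i) (allVecs N′ (n T))) (allFin (n T)) ⟩
      ∑[ i ∈ allFin (n T) ] ∑[ σ′ ∈ allVecs N′ (n T) ] (𝟙 (i =ᶠ lookup σ′ u) * 𝟙 (h (insertAt σ′ j i)))
        ≡⟨ ∑-comm (λ i σ′ → 𝟙 (i =ᶠ lookup σ′ u) * 𝟙 (h (insertAt σ′ j i))) (allFin (n T)) (allVecs N′ (n T)) ⟩
      ∑[ σ′ ∈ allVecs N′ (n T) ] ∑[ i ∈ allFin (n T) ] (𝟙 (i =ᶠ lookup σ′ u) * 𝟙 (h (insertAt σ′ j i)))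
        ≡⟨ ∑-cong (λ σ′ → ∑-select (lookup σ′ u) (λ i → 𝟙 (h (insertAt σ′ j i)))) (allVecs N′ (n T)) ⟩
      count (h ∘ expand) (allVecs N′ (n T))
        ≡⟨ ∑-cong (cong 𝟙 ∘ h-expand) (allVecs N′ (n T)) ⟩
      count h/ (allVecs N′ (n T)) ∎

-- Bipartite graphs and K₂

module _ {G T : Graph} (connected : Connected G) (bipG : Bipartite G) (bipT : Bipartite T)
         (f : Vertex G → Vertex T) (hom : Preserves G T f) where

  private
    side : Vertex G → Bool
    side = proj₁ bipG
    sideT : Vertex T → Bool
    sideT = proj₁ bipT

    walk-invariant : ∀ {u v} → Walk G u v → sideT (f u) xor side u ≡ sideT (f v) xor side v
    walk-invariant []                   = refl
    walk-invariant {u} (_∷_ {v = u′} uu′ walk) = begin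
      sideT (f u) xor side u
        ≡⟨ xor-annihilates-not (sideT (f u)) (side u) ⟨
      not (sideT (f u)) xor not (side u)
        ≡⟨ cong₂ _xor_ (¬-not (proj₂ bipT _ _ (hom u u′ uu′) ∘ sym)) (¬-not (proj₂ bipG u u′ uu′ ∘ sym)) ⟨
      sideT (f u′) xor side u′
        ≡⟨ walk-invariant walk ⟩
      _ ∎

  hom-side-invariant : ∀ u v → sideT (f u) xor side u ≡ sideT (f v) xor side v
  hom-side-invariant u v = walk-invariant (connected u v)

  hom-identifies-same-side : ∀ u v → f u ≡ f v → side u ≡ side v
  hom-identifies-same-side u v fu≡fv =
    xor-cancelˡ (sideT (f u)) (trans (hom-side-invariant u v) (cong (λ t → sideT t xor side v) (sym fu≡fv)))

K₂ : Graph
K₂ = record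
  { n      = 2
  ; adj    = λ p q → not (p =ᶠ q)
  ; sym    = λ p q → cong not (=ᶠ-sym p q)
  ; irrefl = λ p → cong not (dec-true (p ≟ p) refl)
  }

toSide : Fin 2 → Bool
toSide zero       = false
toSide (suc zero) = true

fromSide : Bool → Fin 2
fromSide false = zero
fromSide true  = suc zero

toSide-fromSide : ∀ b → toSide (fromSide b) ≡ b
toSide-fromSide false = refl
toSide-fromSide true  = refl

fromSide-toSide : ∀ p → fromSide (toSide p) ≡ p
fromSide-toSide zero       = refl
fromSide-toSide (suc zero) = refl

K₂-bipartite : Bipartite K₂
K₂-bipartite = toSide , λ where
  zero       zero       ()
  zero       (suc zero) _ ()
  (suc zero) zero       _ ()
  (suc zero) (suc zero) ()

module _ (G : Graph) (connected : Connected G) (bipG : Bipartite G) (w x : Vertex G) (wx : Edge G w x) where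

  private
    side : Vertex G → Bool
    side = proj₁ bipG

    two-colouring : Vec (Fin 2) (n G)
    two-colouring = tabulateᵛ λ v → fromSide (side w xor side v)

    two-colouring-hom : IsHom G K₂ w x zero (suc zero) two-colouring
    two-colouring-hom = isHom
      (trans (lookup∘tabulate _ w) (cong fromSide (xor-same (side w))))
      (trans (lookup∘tabulate _ x) (trans (cong (λ b → fromSide (side w xor b)) (¬-not (proj₂ bipG w x wx ∘ sym)))
                                          (cong fromSide (xor-inverseʳ (side w)))))
      λ u v uv → cong not (dec-false (_ ≟ _) λ τu≡τv → proj₂ bipG u v uv (xor-cancelˡ (side w) (begin
        side w xor side u                         ≡⟨ toSide-fromSide _ ⟨
        toSide (fromSide (side w xor side u))     ≡⟨ cong toSide (lookup∘tabulate _ u) ⟨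
        toSide (lookup two-colouring u)           ≡⟨ cong toSide τu≡τv ⟩
        toSide (lookup two-colouring v)           ≡⟨ cong toSide (lookup∘tabulate _ v) ⟩
        toSide (fromSide (side w xor side v))     ≡⟨ toSide-fromSide _ ⟩
        side w xor side v                         ∎)))

    hom-is-two-colouring : ∀ σ → IsHom G K₂ w x zero (suc zero) σ → σ ≡ two-colouring
    hom-is-two-colouring σ (isHom σw≡0 _ preserves) = lookup-ext λ v → begin
      lookup σ v                      ≡⟨ fromSide-toSide (lookup σ v) ⟨
      fromSide (toSide (lookup σ v))  ≡⟨ cong fromSide (xor-solve (toSide (lookup σ v)) (side v) (side-of v)) ⟩
      fromSide (side w xor side v)    ≡⟨ lookup∘tabulate _ v ⟨
      lookup two-colouring v          ∎
      where
      side-of : ∀ v → toSide (lookup σ v) xor side v ≡ side w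
      side-of v = trans (hom-side-invariant {T = K₂} connected bipG K₂-bipartite (lookup σ) preserves v w)
                        (cong (λ p → toSide p xor side w) σw≡0)

  homCount-K₂ : homCount G K₂ w x zero (suc zero) ≡ 1
  homCount-K₂ = begin
    homCount G K₂ w x zero (suc zero)                          ≡⟨ length-filterᵇ _ (allVecs (n G) 2) ⟩
    count (isHomᵇ G K₂ w x zero (suc zero)) (allVecs (n G) 2)  ≡⟨ ∑-cong (λ σ → cong 𝟙 (unique σ)) (allVecs (n G) 2) ⟩
    ∑[ σ ∈ allVecs (n G) 2 ] 𝟙 (σ =ᵛ two-colouring)           ≡⟨ ∑-cong (λ σ → sym (*-identityʳ _)) (allVecs (n G) 2) ⟩
    ∑[ σ ∈ allVecs (n G) 2 ] (𝟙 (σ =ᵛ two-colouring) * 1)     ≡⟨ ∑-allVecs-select two-colouring (λ _ → 1) ⟩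
    1 ∎
    where
    unique : ∀ σ → isHomᵇ G K₂ w x zero (suc zero) σ ≡ (σ =ᵛ two-colouring)
    unique σ = ⇔→≡ {z = true} (mk⇔
      (λ e → dec-true (≡-dec _≟_ σ two-colouring) (hom-is-two-colouring σ (isHomᵇ-sound e)))
      (λ e → isHomᵇ-complete (subst (IsHom G K₂ w x zero (suc zero))
                                    (sym (does⇒ (≡-dec _≟_ σ two-colouring) e)) two-colouring-hom)))

record Gadget : Set where
  constructor gadget
  field
    graph     : Graph
    connected : Connected graph
    bipartite : Bipartite graph
    w x       : Vertex graph
    wx        : Edge graph w x
open Gadget

homᵇ : (g : Gadget) (T : Graph) → Vertex T → Vertex T → Vec (Vertex T) (n (graph g)) → Bool
homᵇ g T = isHomᵇ (graph g) T (w g) (x g)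

injHomCount : (g : Gadget) (T : Graph) → Vertex T → Vertex T → ℕ → ℕ
injHomCount g T a b = injCount (homᵇ g T a b)

injHomCount-zero : ∀ g T a b → injHomCount g T a b 0 ≡ homCount (graph g) T (w g) (x g) a b
injHomCount-zero g T a b = begin
  injHomCount g T a b 0                            ≡⟨ ∑-cong (λ σ → cong (λ i → 𝟙 (h σ ∧ i)) (injBelowᵇ-zero σ)) L ⟩
  ∑[ σ ∈ L ] 𝟙 (h σ ∧ true)                         ≡⟨ ∑-cong (λ σ → cong 𝟙 (∧-identityʳ (h σ))) L ⟩
  count h L                                        ≡⟨ length-filterᵇ h L ⟨
  homCount (graph g) T (w g) (x g) a b             ∎
  where
  h : Vec (Vertex T) (n (graph g)) → Bool
  h = homᵇ g T a b
  L : List (Vec (Vertex T) (n (graph g)))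
  L = allVecs (n (graph g)) (n T)
  injBelowᵇ-zero : ∀ σ → injBelowᵇ 0 σ ≡ true
  injBelowᵇ-zero σ = dec-true (injectiveBelow? 0 (lookup σ)) λ _ _ ()

collisionCount-different-sides : (g : Gadget) (T : Graph) → Bipartite T → ∀ a b (j u : Vertex (graph g)) →
  proj₁ (bipartite g) u ≢ proj₁ (bipartite g) j → collisionCount (homᵇ g T a b) j u ≡ 0
collisionCount-different-sides g T bipT a b j u sides =
  ∑-zero (λ σ → cong 𝟙 (no-collision σ)) (allVecs (n (graph g)) (n T))
  where
  no-collision : ∀ σ → (homᵇ g T a b σ ∧ injBelowᵇ (toℕ j) σ) ∧ (lookup σ u =ᶠ lookup σ j) ≡ false
  no-collision σ = ¬-not λ e → sides (hom-identifies-same-side {T = T} (connected g) (bipartite g) bipT (lookup σ)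
    (IsHom.preserves (isHomᵇ-sound {graph g} {T} {w g} {x g} {a} {b} {σ} (proj₁ (∧-true (proj₁ (∧-true e)))))) u j
    (does⇒ (lookup σ u ≟ lookup σ j) (proj₂ (∧-true e))))

module _ (H : Graph) (bipH : Bipartite H) (a b : Vertex H) (ab : Edge H a b) where

  ParityMatch : Gadget → ℕ → Set
  ParityMatch g j = injHomCount g H a b j ≡ₚ injHomCount g K₂ zero (suc zero) j or HasEvenGadget H

  parityMatch-zero : ∀ g → ParityMatch g 0
  parityMatch-zero g with parity (homCount (graph g) H (w g) (x g) a b) in homs
  ... | 0ℙ = found (a , b , ab , graph g , connected g , bipartite g , w g , x g , wx g , parity≡0ℙ⇒Even _ homs)
  ... | 1ℙ = agree (begin
    parity (injHomCount g H a b 0)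
      ≡⟨ cong parity (injHomCount-zero g H a b) ⟩
    parity (homCount (graph g) H (w g) (x g) a b)
      ≡⟨ homs ⟩
    parity 1
      ≡⟨ cong parity (homCount-K₂ (graph g) (connected g) (bipartite g) (w g) (x g) (wx g)) ⟨
    parity (homCount (graph g) K₂ (w g) (x g) zero (suc zero))
      ≡⟨ cong parity (injHomCount-zero g K₂ zero (suc zero)) ⟨
    parity (injHomCount g K₂ zero (suc zero) 0) ∎)

  collision-match : (g : Gadget) (j u : Vertex (graph g)) → toℕ u < toℕ j →
    (∀ g′ → toℕ j ≤ n (graph g′) → ParityMatch g′ (toℕ j)) →
    collisionCount (homᵇ g H a b) j u ≡ₚ collisionCount (homᵇ g K₂ zero (suc zero)) j u or HasEvenGadget H
  collision-match g@record { graph = record { n = suc N′ ; adj = A ; sym = A-sym ; irrefl = A-irrefl } } j u u<j IH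
    with punchIn-view j u
  ... | inj₁ refl = contradiction u<j (<-irrefl refl)
  ... | inj₂ (u′ , refl) with proj₁ (bipartite g) (punchIn j u′) ≟ᵇ proj₁ (bipartite g) j
  ...   | no sides = agree (cong parity (trans
            (collisionCount-different-sides g H bipH a b j (punchIn j u′) sides)
            (sym (collisionCount-different-sides g K₂ K₂-bipartite zero (suc zero) j (punchIn j u′) sides))))
  ...   | yes same =
    let open Contraction A A-sym A-irrefl j u′ (¬-not λ ju′ → proj₂ (bipartite g) j (punchIn j u′) ju′ (sym same))
        g/ : Gadget
        g/ = gadget G/ (G/-connected (connected g)) (G/-bipartite (bipartite g) same)
                    (collapse (w g)) (collapse (x g)) (collapse-preserves (w g) (x g) (wx g))
    in subst₂ (λ m n → m ≡ₚ n or HasEvenGadget H)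
              (sym (collisionCount-contraction H (w g) (x g) a b))
              (sym (collisionCount-contraction K₂ (w g) (x g) zero (suc zero)))
              (IH g/ (≤-pred (toℕ<n j)))

  earlierCollisions : (g : Gadget) (T : Graph) → Vertex T → Vertex T → (j u : Vertex (graph g)) → ℕ
  earlierCollisions g T c d j u = 𝟙 (does (toℕ u <? toℕ j)) * collisionCount (homᵇ g T c d) j u

  earlierCollisions-match : (g : Gadget) (j : Vertex (graph g)) →
    (∀ g′ → toℕ j ≤ n (graph g′) → ParityMatch g′ (toℕ j)) →
    ∀ u → earlierCollisions g H a b j u ≡ₚ earlierCollisions g K₂ zero (suc zero) j u or HasEvenGadget H
  earlierCollisions-match g j IH u = ≡ₚ-or-𝟙* (toℕ u <? toℕ j) λ u<j → collision-match g j u u<j IH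

  parityMatch-suc : (g : Gadget) (j : Vertex (graph g)) →
    (∀ g′ → toℕ j ≤ n (graph g′) → ParityMatch g′ (toℕ j)) → ParityMatch g (suc (toℕ j))
  parityMatch-suc g j IH
    with IH g (<⇒≤ (toℕ<n j))
       | ≡ₚ-or-∑ {f = earlierCollisions g H a b j} {g = earlierCollisions g K₂ zero (suc zero) j}
                 (earlierCollisions-match g j IH) (allFin (n (graph g)))
  ... | found even  | _            = found even
  ... | agree _     | found even   = found even
  ... | agree before | agree during = agree (parity-cancelʳ (later H a b) (later K₂ zero (suc zero))
                                                             (earlier H a b) (earlier K₂ zero (suc zero))
      (trans (cong parity (sym (injCount-suc (homᵇ g H a b) j)))
             (trans before (cong parity (injCount-suc (homᵇ g K₂ zero (suc zero)) j))))
      during)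
    where
    later earlier : (T : Graph) → Vertex T → Vertex T → ℕ
    later   T c d = injHomCount g T c d (suc (toℕ j))
    earlier T c d = ∑ (earlierCollisions g T c d j) (allFin (n (graph g)))

  parityMatch : ∀ j (g : Gadget) → j ≤ n (graph g) → ParityMatch g j
  parityMatch zero    g _   = parityMatch-zero g
  parityMatch (suc j) g j<n = subst (ParityMatch g ∘ suc) (toℕ-fromℕ< j<n) (parityMatch-suc g (fromℕ< j<n) IH)
    where
    IH : ∀ g′ → toℕ (fromℕ< j<n) ≤ n (graph g′) → ParityMatch g′ (toℕ (fromℕ< j<n))
    IH g′ rewrite toℕ-fromℕ< j<n = parityMatch j g′

-- Automorphisms

injective⇒surjective : (f : Fin m → Fin m) → Injective _≡_ _≡_ f → ∀ y → ∃ λ x → f x ≡ y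
injective⇒surjective {suc m} f f-injective y with any? (λ x → f x ≟ y)
... | yes hit  = hit
... | no  miss = contradiction (injective⇒≤ squeeze-injective) (1+n≰n {m})
  where
  squeeze : Fin (suc m) → Fin m
  squeeze x = punchOut {i = y} {j = f x} λ y≡fx → miss (x , sym y≡fx)
  squeeze-injective : Injective _≡_ _≡_ squeeze
  squeeze-injective {x} {x′} eq =
    f-injective (punchOut-injective {i = y} (λ y≡fx → miss (x , sym y≡fx)) (λ y≡fx′ → miss (x′ , sym y≡fx′)) eq)

module _ {m : ℕ} (f : Fin m → Fin m) where

  preimage : Fin m → Fin m
  preimage y with any? (λ x → f x ≟ y)
  ... | yes (x , _) = x
  ... | no  _       = y

  preimage-inverseʳ : Injective _≡_ _≡_ f → ∀ y → f (preimage y) ≡ y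
  preimage-inverseʳ f-injective y with any? (λ x → f x ≟ y)
  ... | yes (x , fx≡y) = fx≡y
  ... | no  miss       = contradiction (injective⇒surjective f f-injective y) miss

inverse : Vec (Fin m) m → Vec (Fin m) m
inverse σ = tabulateᵛ (preimage (lookup σ))

module _ {m : ℕ} (σ : Vec (Fin m) m) (σ-injective : Injective _≡_ _≡_ (lookup σ)) where

  inverseʳ : ∀ y → lookup σ (lookup (inverse σ) y) ≡ y
  inverseʳ y = trans (cong (lookup σ) (lookup∘tabulate _ y)) (preimage-inverseʳ (lookup σ) σ-injective y)

  inverseˡ : ∀ x → lookup (inverse σ) (lookup σ x) ≡ x
  inverseˡ x = σ-injective (inverseʳ (lookup σ x))

  inverse-injective : Injective _≡_ _≡_ (lookup (inverse σ))
  inverse-injective {y} {y′} eq = trans (sym (inverseʳ y)) (trans (cong (lookup σ) eq) (inverseʳ y′))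

inverse-involutive : (σ : Vec (Fin m) m) → Injective _≡_ _≡_ (lookup σ) → inverse (inverse σ) ≡ σ
inverse-involutive σ σ-injective = lookup-ext λ x → begin
  lookup (inverse (inverse σ)) x
    ≡⟨ cong (lookup (inverse (inverse σ))) (inverseˡ σ σ-injective x) ⟨
  lookup (inverse (inverse σ)) (lookup (inverse σ) (lookup σ x))
    ≡⟨ inverseˡ (inverse σ) (inverse-injective σ σ-injective) (lookup σ x) ⟩
  lookup σ x ∎

module _ (H : Graph) (σ : Vec (Vertex H) (n H)) (σ-injective : Injective _≡_ _≡_ (lookup σ))
         (σ-preserves : Preserves H H (lookup σ)) where

  private
    edgeᵇ : Vec (Vertex H) 2 → Bool
    edgeᵇ (u ∷ v ∷ []) = adj H u v

    both : (Vertex H → Vertex H) → Vec (Vertex H) 2 → Vec (Vertex H) 2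
    both f (u ∷ v ∷ []) = f u ∷ f v ∷ []

    σ⁻¹ : Vertex H → Vertex H
    σ⁻¹ = lookup (inverse σ)

    edges-preserved : ∀ e → edgeᵇ e ≡ true → edgeᵇ (both (lookup σ) e) ≡ true
    edges-preserved (u ∷ v ∷ []) = σ-preserves u v

    same-count : count (edgeᵇ ∘ both (lookup σ)) (allVecs 2 (n H)) ≡ count edgeᵇ (allVecs 2 (n H))
    same-count = count-bijection (both (lookup σ)) (both σ⁻¹)
      (λ e edge → edge)
      (λ where (u ∷ v ∷ []) edge → subst₂ (Edge H) (sym (inverseʳ σ σ-injective u)) (sym (inverseʳ σ σ-injective v)) edge)
      (λ where (u ∷ v ∷ []) _ → cong₂ (λ u′ v′ → u′ ∷ v′ ∷ []) (inverseˡ σ σ-injective u) (inverseˡ σ σ-injective v))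
      (λ where (u ∷ v ∷ []) _ → cong₂ (λ u′ v′ → u′ ∷ v′ ∷ []) (inverseʳ σ σ-injective u) (inverseʳ σ σ-injective v))

  -- σ × σ permutes the ordered pairs of vertices and maps edges to edges, hence onto them.
  injective-endomorphism-reflects : ∀ u v → Edge H (lookup σ u) (lookup σ v) → Edge H u v
  injective-endomorphism-reflects u v = count-≡⇒⊇ edges-preserved (sym same-count) (u ∷ v ∷ [])

identity : Vec (Fin m) m
identity = tabulateᵛ id

module _ (H : Graph) (a b : Vertex H) where

  Autᵇ : Vec (Vertex H) (n H) → Bool
  Autᵇ σ = isHomᵇ H H a b a b σ ∧ injBelowᵇ (n H) σ

  record IsAut (σ : Vec (Vertex H) (n H)) : Set where
    field
      hom       : IsHom H H a b a b σ
      injective : Injective _≡_ _≡_ (lookup σ)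

  Autᵇ-sound : ∀ σ → Autᵇ σ ≡ true → IsAut σ
  Autᵇ-sound σ e = record
    { hom       = isHomᵇ-sound (proj₁ (∧-true e))
    ; injective = injectiveBelow⇒injective (does⇒ (injectiveBelow? (n H) (lookup σ)) (proj₂ (∧-true e))) }

  Autᵇ-complete : ∀ σ → IsAut σ → Autᵇ σ ≡ true
  Autᵇ-complete σ aut = cong₂ _∧_ (isHomᵇ-complete (IsAut.hom aut))
    (dec-true (injectiveBelow? (n H) (lookup σ)) (injective⇒injectiveBelow (IsAut.injective aut)))

  inverse-aut : ∀ σ → IsAut σ → IsAut (inverse σ)
  inverse-aut σ record { hom = isHom σa≡a σb≡b σ-preserves ; injective = σ-injective } = record
    { hom = isHom (fixes σa≡a) (fixes σb≡b) λ u v uv →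
        injective-endomorphism-reflects H σ σ-injective σ-preserves _ _
          (subst₂ (Edge H) (sym (inverseʳ σ σ-injective u)) (sym (inverseʳ σ σ-injective v)) uv)
    ; injective = inverse-injective σ σ-injective }
    where
    fixes : ∀ {c} → lookup σ c ≡ c → lookup (inverse σ) c ≡ c
    fixes {c} σc≡c = trans (cong (lookup (inverse σ)) (sym σc≡c)) (inverseˡ σ σ-injective c)

  identity-aut : IsAut identity
  identity-aut = record
    { hom       = isHom (lookup∘tabulate id a) (lookup∘tabulate id b)
                        λ u v uv → subst₂ (Edge H) (sym (lookup∘tabulate id u)) (sym (lookup∘tabulate id v)) uv
    ; injective = λ {u} {v} eq → trans (sym (lookup∘tabulate id u)) (trans eq (lookup∘tabulate id v)) }

  inverse-identity : inverse (identity {n H}) ≡ identity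
  inverse-identity = lookup-ext λ y → begin
    lookup (inverse identity) y                    ≡⟨ cong (lookup (inverse identity)) (lookup∘tabulate id y) ⟨
    lookup (inverse identity) (lookup identity y)  ≡⟨ inverseˡ identity (IsAut.injective identity-aut) y ⟩
    y                                              ≡⟨ lookup∘tabulate id y ⟨
    lookup identity y                              ∎

  module _ (involution-free : InvolutionFree H a b) where

    self-inverse⇒identity : ∀ σ → IsAut σ → inverse σ ≡ σ → σ ≡ identity
    self-inverse⇒identity σ record { hom = isHom σa≡a σb≡b σ-preserves ; injective = σ-injective } σ⁻¹≡σ
      with all? (λ u → lookup σ u ≟ u)
    ... | yes fixes-all = lookup-ext λ u → trans (fixes-all u) (sym (lookup∘tabulate id u))
    ... | no  moves     =
      contradiction (φ , (σ∘σ≗id , ¬∀⟶∃¬ (n H) _ (λ u → lookup σ u ≟ u) moves) , σa≡a , σb≡b) involution-free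
      where
      σ∘σ≗id : ∀ u → lookup σ (lookup σ u) ≡ u
      σ∘σ≗id u = trans (cong (λ τ → lookup σ (lookup τ u)) (sym σ⁻¹≡σ)) (inverseʳ σ σ-injective u)
      φ : Automorphism H
      φ = record
        { fun = lookup σ ; inv = lookup σ ; inv-l = σ∘σ≗id ; inv-r = σ∘σ≗id
        ; preserv = λ u v → ⇔→≡ {z = true}
                      (mk⇔ (injective-endomorphism-reflects H σ σ-injective σ-preserves u v) (σ-preserves u v))
        }

    self-inverse-automorphisms : ∀ σ → (Autᵇ σ ∧ (inverse σ =ᵛ σ)) ≡ (σ =ᵛ identity)
    self-inverse-automorphisms σ = ⇔→≡ {z = true} (mk⇔ to from)
      where
      to : Autᵇ σ ∧ (inverse σ =ᵛ σ) ≡ true → σ =ᵛ identity ≡ true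
      to e = dec-true (≡-dec _≟_ σ identity) (self-inverse⇒identity σ (Autᵇ-sound σ (proj₁ (∧-true e)))
                                                (does⇒ (≡-dec _≟_ (inverse σ) σ) (proj₂ (∧-true e))))
      from : σ =ᵛ identity ≡ true → Autᵇ σ ∧ (inverse σ =ᵛ σ) ≡ true
      from e with refl ← does⇒ (≡-dec _≟_ σ identity) e =
        cong₂ _∧_ (Autᵇ-complete identity identity-aut) (dec-true (≡-dec _≟_ (inverse identity) identity) inverse-identity)

    automorphisms-odd : parity (count Autᵇ (allVecs (n H) (n H))) ≡ 1ℙ
    automorphisms-odd = begin
      parity (count Autᵇ L)                                ≡⟨ involution-parity inverse closed involutive ⟩
      parity (count (λ σ → Autᵇ σ ∧ (inverse σ =ᵛ σ)) L)    ≡⟨ cong parity (∑-cong (cong 𝟙 ∘ self-inverse-automorphisms) L) ⟩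
      parity (∑[ σ ∈ L ] 𝟙 (σ =ᵛ identity))                 ≡⟨ cong parity (∑-cong (λ σ → sym (*-identityʳ _)) L) ⟩
      parity (∑[ σ ∈ L ] (𝟙 (σ =ᵛ identity) * 1))           ≡⟨ cong parity (∑-allVecs-select {n H} identity (λ _ → 1)) ⟩
      parity 1                                             ∎
      where
      L : List (Vec (Vertex H) (n H))
      L = allVecs (n H) (n H)
      closed : ∀ σ → Autᵇ σ ≡ true → Autᵇ (inverse σ) ≡ true
      closed σ e = Autᵇ-complete (inverse σ) (inverse-aut σ (Autᵇ-sound σ e))
      involutive : ∀ σ → Autᵇ σ ≡ true → inverse (inverse σ) ≡ σ
      involutive σ e = inverse-involutive σ (IsAut.injective (Autᵇ-sound σ e))

edge⇒≢ : (G : Graph) {p q : Vertex G} → Edge G p q → p ≢ q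
edge⇒≢ G {p} pq refl = contradiction (trans (sym pq) (irrefl G p)) λ ()

three-distinct-vertices : (H : Graph) → MoreThanOneEdge H →
  Σ (Vertex H) λ p → Σ (Vertex H) λ q → Σ (Vertex H) λ r → p ≢ q × q ≢ r × p ≢ r
three-distinct-vertices H (u , v , u′ , v′ , uv , u′v′ , different) with u′ ≟ u | u′ ≟ v
... | no u′≢u   | no u′≢v = u , v , u′ , edge⇒≢ H uv , u′≢v ∘ sym , u′≢u ∘ sym
... | yes refl  | _       = u , v , v′ , edge⇒≢ H uv , (λ v≡v′ → different (inj₁ (refl , v≡v′))) , edge⇒≢ H u′v′
... | no _      | yes refl = u , v , v′ , edge⇒≢ H uv , edge⇒≢ H u′v′ , (λ u≡v′ → different (inj₂ (u≡v′ , refl)))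

Fin2-no-three-distinct : (x y z : Fin 2) → x ≢ y → y ≢ z → x ≢ z → ⊥
Fin2-no-three-distinct zero       zero       _          x≢y _   _   = x≢y refl
Fin2-no-three-distinct zero       (suc zero) zero       _   _   x≢z = x≢z refl
Fin2-no-three-distinct zero       (suc zero) (suc zero) _   y≢z _   = y≢z refl
Fin2-no-three-distinct (suc zero) zero       zero       _   y≢z _   = y≢z refl
Fin2-no-three-distinct (suc zero) zero       (suc zero) _   _   x≢z = x≢z refl
Fin2-no-three-distinct (suc zero) (suc zero) _          x≢y _   _   = x≢y refl

no-injection-into-K₂ : (H : Graph) → MoreThanOneEdge H → ∀ a b →
  count (λ σ → isHomᵇ H K₂ a b zero (suc zero) σ ∧ injBelowᵇ (n H) σ) (allVecs (n H) 2) ≡ 0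
no-injection-into-K₂ H more a b =
  ∑-zero (λ σ → cong 𝟙 (¬-not (not-injective-into-K₂ σ ∘ proj₂ ∘ ∧-true))) (allVecs (n H) 2)
  where
  not-injective-into-K₂ : ∀ σ → injBelowᵇ (n H) σ ≢ true
  not-injective-into-K₂ σ e with three-distinct-vertices H more
  ... | p , q , r , p≢q , q≢r , p≢r =
    Fin2-no-three-distinct (lookup σ p) (lookup σ q) (lookup σ r) (p≢q ∘ inj) (q≢r ∘ inj) (p≢r ∘ inj)
    where
    inj : Injective _≡_ _≡_ (lookup σ)
    inj = injectiveBelow⇒injective (does⇒ (injectiveBelow? (n H) (lookup σ)) e)

lemma5p15 : (H : Graph) → Connected H → Bipartite H → MoreThanOneEdge H →
    Σ (Vertex H) (λ a → Σ (Vertex H) (λ b → Edge H a b × InvolutionFree H a b)) →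
    HasEvenGadget H
lemma5p15 H connected bipartite more (a , b , ab , involution-free)
  with parityMatch H bipartite a b ab (n H) (gadget H connected bipartite a b ab) ≤-refl
... | found even  = even
... | agree match = contradiction (begin
    1ℙ                                                  ≡⟨ automorphisms-odd H a b involution-free ⟨
    parity (count (Autᵇ H a b) (allVecs (n H) (n H)))   ≡⟨ match ⟩
    parity (injHomCount (gadget H connected bipartite a b ab) K₂ zero (suc zero) (n H))
      ≡⟨ cong parity (no-injection-into-K₂ H more a b) ⟩
    0ℙ ∎) λ ()
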